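{- The weakly convex domination number $\gamma_{\rm wcon}$ is an interpolating function: for every connected graph $G$, the set $\{\gamma_{\rm wcon}(T): T \text{ a spanning tree of } G\}$ consists of consecutive integers.
   Context: Graphs are finite, simple, undirected. A set $D$ is dominating if every vertex outside $D$ has a neighbour in $D$; weakly convex if for any $a,b\in D$ some shortest $(a-b)$-path in the graph lies in $D$; $\gamma_{\rm wcon}(G)$ is the minimum size of a weakly convex dominating set. An integer-valued graph function $\Pi$ interpolates over $G$ if $\{\Pi(T): T$ a spanning tree of $G\}$ is a set of consecutive integers; $\Pi$ is an interpolating function if it interpolates over every connected graph. -}

module Defs where

open import Data.Nat using (ℕ; zero; suc; _≤_; _<_)
open import Data.Bool using (Bool; true; false)
open import Data.Fin using (Fin; fromℕ; inject₁) renaming (zero to fzero; suc to fsuc)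
open import Data.Fin.Subset using (Subset; _∈_; ∣_∣)
open import Data.Product using (Σ; ∃; ∃-syntax; _×_; _,_)
open import Data.Sum using (_⊎_)
open import Data.Unit using (⊤)
open import Relation.Nullary using (¬_)
open import Relation.Binary.PropositionalEquality using (_≡_)
open import Function.Definitions using (Injective)

record Graph (n : ℕ) : Set where
  field
    adj     : Fin n → Fin n → Bool
    adj-sym : ∀ u v → adj u v ≡ adj v u
    irrefl  : ∀ v → adj v v ≡ false
open Graph public

Adj : ∀ {n} → Graph n → Fin n → Fin n → Set
Adj G u v = adj G u v ≡ true

data WalkIn {n : ℕ} (G : Graph n) (P : Fin n → Set) : Fin n → Fin n → ℕ → Set where
  here : ∀ {a} → P a → WalkIn G P a a 0
  step : ∀ {a b c k} → P a → Adj G a b → WalkIn G P b c k → WalkIn G P a c (suc k)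

Walk : ∀ {n} → Graph n → Fin n → Fin n → ℕ → Set
Walk G = WalkIn G (λ _ → ⊤)

Connected : ∀ {n} → Graph n → Set
Connected G = ∀ a b → ∃[ k ] Walk G a b k

HasCycle : ∀ {n} → Graph n → Set
HasCycle {n} G =
  ∃[ m ] Σ (Fin (suc (suc (suc m))) → Fin n) λ f →
    Injective _≡_ _≡_ f
    × (∀ (i : Fin (suc (suc m))) → Adj G (f (inject₁ i)) (f (fsuc i)))
    × Adj G (f (fromℕ (suc (suc m)))) (f fzero)

Acyclic : ∀ {n} → Graph n → Set
Acyclic G = ¬ HasCycle G

IsTree : ∀ {n} → Graph n → Set
IsTree G = Connected G × Acyclic G

IsSpanningTree : ∀ {n} → Graph n → Graph n → Set
IsSpanningTree G T = (∀ u v → Adj T u v → Adj G u v) × IsTree T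

Dominating : ∀ {n} → Graph n → Subset n → Set
Dominating G D = ∀ v → v ∈ D ⊎ ∃[ u ] (u ∈ D × Adj G u v)

WeaklyConvex : ∀ {n} → Graph n → Subset n → Set
WeaklyConvex G D =
  ∀ a b → a ∈ D → b ∈ D →
    ∃[ k ] (WalkIn G (_∈ D) a b k × (∀ m → Walk G a b m → k ≤ m))

IsWCD : ∀ {n} → Graph n → Subset n → Set
IsWCD G D = Dominating G D × WeaklyConvex G D

γwcon≡ : ∀ {n} → Graph n → ℕ → Set
γwcon≡ G k = (∃[ D ] (IsWCD G D × ∣ D ∣ ≡ k)) × (∀ D → IsWCD G D → k ≤ ∣ D ∣)

-- In a tree with at least one vertex, every weakly convex dominating set contains each vertex of
-- degree at least two (if it missed one, it would join two of its neighbours by a path avoiding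
-- it, closing a cycle), and these vertices (a single vertex, if there are none) form such a set.
-- So γ_wcon(T) = max(1, number of non-leaves of T).
--
-- Spanning trees are encoded as parent maps towards a fixed root. Re-attaching one vertex v to a
-- neighbour that does not descend from v gives another spanning tree, and the non-leaves of the
-- two trees agree except for at most one vertex on each side, so γ_wcon moves by at most 1.
-- Starting from one spanning tree and repeatedly re-attaching, to its parent in the other tree, a
-- mismatched vertex of least height in the other tree, we reach the other tree after finitely many
-- steps, so every value in between is attained.

module Submission where

open import Defs
open import Data.Bool using (true; false)
import Data.Bool.Properties as Bool
open import Data.Empty using (⊥-elim)
open import Data.Fin using (Fin; fromℕ; inject₁) renaming (zero to fzero; suc to fsuc)
open import Data.Fin.Properties using (any?; fromℕ≢inject₁; suc-injective) renaming (_≟_ to _≟ᶠ_)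
open import Data.Fin.Subset using (Subset; _∈_; ∣_∣; ⁅_⁆; _⊆_)
open import Data.Fin.Subset.Properties
  using ( _∈?_; p⊆q⇒∣p∣≤∣q∣; drop-there; p⊂q⇒∣p∣<∣q∣; ∣p∣≤∣x∷p∣; ∣⁅x⁆∣≡1; x∈⁅x⁆; x∈⁅y⁆⇒x≡y
        ; ⊆-antisym; nonempty?; Empty-unique; ∣⊥∣≡0)
open import Data.Nat using (ℕ; zero; suc; _+_; _⊔_; _≤_; _<_; z≤n; s≤s) renaming (_≟_ to _≟ⁿ_)
open import Data.Nat.Properties
  using ( ≤-refl; ≤-trans; ≤-antisym; <-irrefl; <-trans; <⇒≤; ≤-<-trans; <-≤-trans; n≤1+n; n≮0; ≤-pred; ≤∧≢⇒<
        ; ⊔-lub; m≤n⊔m; m≤n⇒m⊔n≡n)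
open import Data.Product using (Σ; ∃; ∃-syntax; _×_; _,_; proj₁; proj₂)
open import Data.Sum using (_⊎_; inj₁; inj₂)
open import Data.Unit using (tt)
open import Data.Vec using (_∷_; []; tabulate) renaming (here to hereᵛ; there to thereᵛ)
open import Data.Vec.Properties using (lookup∘tabulate; []=⇒lookup; lookup⇒[]=)
open import Function.Definitions using (Injective)
open import Relation.Nullary using (¬_; Dec; yes; no; does)
open import Relation.Nullary.Decidable using (dec-true; ¬?; _×-dec_; _⊎-dec_)
open import Relation.Binary.PropositionalEquality using (_≡_; _≢_; refl; sym; trans; cong; subst)

private
  variable
    n : ℕ
    A : Set

does-true⇒ : (d : Dec A) → does d ≡ true → A
does-true⇒ (yes a) _ = a
does-true⇒ (no _) ()

subsetOf : {P : Fin n → Set} → (∀ x → Dec (P x)) → Subset n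
subsetOf P? = tabulate (λ x → does (P? x))

module _ {P : Fin n → Set} (P? : ∀ x → Dec (P x)) where

  ∈subsetOf⁻ : ∀ {x} → x ∈ subsetOf P? → P x
  ∈subsetOf⁻ {x} x∈ = does-true⇒ (P? x) (trans (sym (lookup∘tabulate _ x)) ([]=⇒lookup x∈))

  ∈subsetOf⁺ : ∀ {x} → P x → x ∈ subsetOf P?
  ∈subsetOf⁺ {x} px = lookup⇒[]= x _ (trans (lookup∘tabulate _ x) (dec-true (P? x) px))

x∈p⇒1≤∣p∣ : ∀ {p : Subset n} {x} → x ∈ p → 1 ≤ ∣ p ∣
x∈p⇒1≤∣p∣ {p = p} {x} x∈p =
  subst (_≤ ∣ p ∣) (∣⁅x⁆∣≡1 x) (p⊆q⇒∣p∣≤∣q∣ λ {y} y∈⁅x⁆ → subst (_∈ p) (sym (x∈⁅y⁆⇒x≡y x y∈⁅x⁆)) x∈p)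

∣p∣≤1+∣q∣ : ∀ (p q : Subset n) x → (∀ {y} → y ≢ x → y ∈ p → y ∈ q) → ∣ p ∣ ≤ suc ∣ q ∣
∣p∣≤1+∣q∣ (s ∷ p) (t ∷ q) fzero p⊆q =
  ≤-trans (∣s∷p∣≤1+∣p∣ s) (s≤s (≤-trans (p⊆q⇒∣p∣≤∣q∣ (λ y∈p → drop-there (p⊆q (λ ()) (thereᵛ y∈p))))
                                        (∣p∣≤∣x∷p∣ t q)))
  where
  ∣s∷p∣≤1+∣p∣ : ∀ s → ∣ s ∷ p ∣ ≤ suc ∣ p ∣
  ∣s∷p∣≤1+∣p∣ true  = ≤-refl
  ∣s∷p∣≤1+∣p∣ false = n≤1+n _
∣p∣≤1+∣q∣ (true ∷ p) (t ∷ q) (fsuc x) p⊆q with p⊆q {fzero} (λ ()) hereᵛ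
... | hereᵛ = s≤s (∣p∣≤1+∣q∣ p q x λ y≢x y∈p → drop-there (p⊆q (λ e → y≢x (suc-injective e)) (thereᵛ y∈p)))
∣p∣≤1+∣q∣ (false ∷ p) (t ∷ q) (fsuc x) p⊆q =
  ≤-trans (∣p∣≤1+∣q∣ p q x λ y≢x y∈p → drop-there (p⊆q (λ e → y≢x (suc-injective e)) (thereᵛ y∈p)))
          (s≤s (∣p∣≤∣x∷p∣ t q))

Adj? : (H : Graph n) → ∀ x y → Dec (Adj H x y)
Adj? H x y = adj H x y Bool.≟ true

Adj-sym : (H : Graph n) → ∀ {x y} → Adj H x y → Adj H y x
Adj-sym H {x} {y} xy = trans (adj-sym H y x) xy

Adj⇒≢ : (H : Graph n) → ∀ {x y} → Adj H x y → x ≢ y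
Adj⇒≢ H {x} xx refl with trans (sym xx) (irrefl H x)
... | ()

record SimpleRelation (n : ℕ) : Set₁ where
  field
    _∼_      : Fin n → Fin n → Set
    _∼?_     : ∀ x y → Dec (x ∼ y)
    ∼-sym    : ∀ {x y} → x ∼ y → y ∼ x
    ∼-irrefl : ∀ {x} → ¬ x ∼ x

module _ (R : SimpleRelation n) where
  open SimpleRelation R

  toGraph : Graph n
  toGraph = record { adj = λ x y → does (x ∼? y) ; adj-sym = does-sym ; irrefl = does-irrefl }
    where
    does-sym : ∀ x y → does (x ∼? y) ≡ does (y ∼? x)
    does-sym x y with x ∼? y | y ∼? x
    ... | yes _   | yes _   = refl
    ... | no _    | no _    = refl
    ... | yes x∼y | no y≁x  = ⊥-elim (y≁x (∼-sym x∼y))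
    ... | no x≁y  | yes y∼x = ⊥-elim (x≁y (∼-sym y∼x))
    does-irrefl : ∀ x → does (x ∼? x) ≡ false
    does-irrefl x with x ∼? x
    ... | yes x∼x = ⊥-elim (∼-irrefl x∼x)
    ... | no _    = refl

  toGraph⁻ : ∀ {x y} → Adj toGraph x y → x ∼ y
  toGraph⁻ {x} {y} = does-true⇒ (x ∼? y)

  toGraph⁺ : ∀ {x y} → x ∼ y → Adj toGraph x y
  toGraph⁺ {x} {y} = dec-true (x ∼? y)

SameEdge : Fin n → Fin n → Fin n → Fin n → Set
SameEdge u v x y = (x ≡ u × y ≡ v) ⊎ (x ≡ v × y ≡ u)

SameEdge-sym : ∀ {u v x y : Fin n} → SameEdge u v x y → SameEdge u v y x
SameEdge-sym (inj₁ (x≡u , y≡v)) = inj₂ (y≡v , x≡u)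
SameEdge-sym (inj₂ (x≡v , y≡u)) = inj₁ (y≡u , x≡v)

withoutEdge : Graph n → Fin n → Fin n → SimpleRelation n
withoutEdge H u v = record
  { _∼_      = λ x y → Adj H x y × ¬ SameEdge u v x y
  ; _∼?_     = λ x y → Adj? H x y ×-dec ¬? ((x ≟ᶠ u ×-dec y ≟ᶠ v) ⊎-dec (x ≟ᶠ v ×-dec y ≟ᶠ u))
  ; ∼-sym    = λ (xy , ¬e) → Adj-sym H xy , λ e → ¬e (SameEdge-sym e)
  ; ∼-irrefl = λ (xx , _) → Adj⇒≢ H xx refl
  }

deleteEdge : Graph n → Fin n → Fin n → Graph n
deleteEdge H u v = toGraph (withoutEdge H u v)

module _ (H : Graph n) (u v : Fin n) where

  deleteEdge⁻ : ∀ {x y} → Adj (deleteEdge H u v) x y → Adj H x y × ¬ SameEdge u v x y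
  deleteEdge⁻ = toGraph⁻ (withoutEdge H u v)

  deleteEdge⁺ : ∀ {x y} → Adj H x y → ¬ SameEdge u v x y → Adj (deleteEdge H u v) x y
  deleteEdge⁺ xy ¬e = toGraph⁺ (withoutEdge H u v) (xy , ¬e)

module _ {H : Graph n} where

  mapWalk : ∀ {P Q : Fin n → Set} → (∀ {x} → P x → Q x) → ∀ {a b k} → WalkIn H P a b k → WalkIn H Q a b k
  mapWalk f (here pa)       = here (f pa)
  mapWalk f (step pa ab w)  = step (f pa) ab (mapWalk f w)

  first∈ : ∀ {P : Fin n → Set} {a b k} → WalkIn H P a b k → P a
  first∈ (here pa)     = pa
  first∈ (step pa _ _) = pa

  _++ʷ_ : ∀ {P : Fin n → Set} {a b c k l} → WalkIn H P a b k → WalkIn H P b c l → WalkIn H P a c (k + l)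
  here _        ++ʷ w′ = w′
  step pa ab w  ++ʷ w′ = step pa ab (w ++ʷ w′)

  reverse : ∀ {P : Fin n → Set} {a b k} → WalkIn H P a b k → ∃[ l ] WalkIn H P b a l
  reverse (here pa) = 0 , here pa
  reverse (step pa ab w) = _ , (proj₂ (reverse w) ++ʷ step (first∈ w) (Adj-sym H ab) (here pa))

  vertex : ∀ {P : Fin n → Set} {a b k} → WalkIn H P a b k → Fin (suc k) → Fin n
  vertex {a = a} (here _)     fzero    = a
  vertex {a = a} (step _ _ _) fzero    = a
  vertex         (step _ _ w) (fsuc i) = vertex w i

  vertex-first : ∀ {P : Fin n → Set} {a b k} (w : WalkIn H P a b k) → vertex w fzero ≡ a
  vertex-first (here _)     = refl
  vertex-first (step _ _ _) = refl

  vertex-last : ∀ {P : Fin n → Set} {a b k} (w : WalkIn H P a b k) → vertex w (fromℕ k) ≡ b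
  vertex-last (here _)     = refl
  vertex-last (step _ _ w) = vertex-last w

  vertex-adj : ∀ {P : Fin n → Set} {a b k} (w : WalkIn H P a b k) (i : Fin k) →
               Adj H (vertex w (inject₁ i)) (vertex w (fsuc i))
  vertex-adj (step _ ab (here _))     fzero    = ab
  vertex-adj (step _ ab (step _ _ _)) fzero    = ab
  vertex-adj (step _ _  w)            (fsuc i) = vertex-adj w i

  IsPath : ∀ {P : Fin n → Set} {a b k} → WalkIn H P a b k → Set
  IsPath w = Injective _≡_ _≡_ (vertex w)

  suffix : ∀ {P : Fin n → Set} {a b k} (w : WalkIn H P a b k) (i : Fin (suc k)) →
           ∃[ l ] Σ (WalkIn H P (vertex w i) b l) λ w′ → IsPath w → IsPath w′
  suffix (here pa)      fzero    = 0 , here pa , λ path → path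
  suffix (step pa ab w) fzero    = _ , step pa ab w , λ path → path
  suffix (step pa ab w) (fsuc i) with suffix w i
  ... | l , w′ , path⇒path = l , w′ , λ path → path⇒path (λ e → suc-injective (path e))

  toPath : ∀ {P : Fin n → Set} {a b k} → WalkIn H P a b k → ∃[ l ] Σ (WalkIn H P a b l) IsPath
  toPath (here pa) = 0 , here pa , λ { {fzero} {fzero} _ → refl }
  toPath {a = a} (step pa ab w) with toPath w
  ... | l , p , path with any? (λ i → vertex p i ≟ᶠ a)
  ...   | yes (i , pᵢ≡a) = shortcut pᵢ≡a (suffix p i)
    where
    shortcut : ∀ {x} → x ≡ a → ∃[ l′ ] Σ (WalkIn H _ x _ l′) (λ p′ → IsPath p → IsPath p′) →
               ∃[ l′ ] Σ (WalkIn H _ a _ l′) IsPath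
    shortcut refl (l′ , p′ , path⇒path) = l′ , p′ , path⇒path path
  ...   | no a∉p = suc l , step pa ab p , path′
    where
    path′ : IsPath (step pa ab p)
    path′ {fzero}  {fzero}  _ = refl
    path′ {fzero}  {fsuc j} e = ⊥-elim (a∉p (j , sym e))
    path′ {fsuc i} {fzero}  e = ⊥-elim (a∉p (i , e))
    path′ {fsuc i} {fsuc j} e = cong fsuc (path e)

acyclic⇒bridge : (H : Graph n) → Acyclic H → ∀ {u v k} → Adj H u v → ¬ Walk (deleteEdge H u v) u v k
acyclic⇒bridge H acyclic {u} {v} uv w with toPath w
... | zero , here _ , _ = Adj⇒≢ H uv refl
... | suc zero , step _ uv′ (here _) , _ = proj₂ (deleteEdge⁻ H u v uv′) (inj₁ (refl , refl))
... | suc (suc m) , p , path = acyclic (m , vertex p , path , along , closing)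
  where
  along : ∀ i → Adj H (vertex p (inject₁ i)) (vertex p (fsuc i))
  along i = proj₁ (deleteEdge⁻ H u v (vertex-adj p i))
  closing : Adj H (vertex p (fromℕ (suc (suc m)))) (vertex p fzero)
  closing rewrite vertex-last p | vertex-first p = Adj-sym H uv

walkThrough : ∀ {H : Graph n} m (g : Fin (suc m) → Fin n) →
              (∀ i → Adj H (g (inject₁ i)) (g (fsuc i))) → Walk H (g fzero) (g (fromℕ m)) m
walkThrough zero    g _     = here tt
walkThrough (suc m) g along = step tt (along fzero) (walkThrough m (λ i → g (fsuc i)) (λ i → along (fsuc i)))

cycle⇒nonBridge : (H : Graph n) → HasCycle H → ∃[ u ] ∃[ v ] (Adj H u v × ∃[ k ] Walk (deleteEdge H u v) u v k)
cycle⇒nonBridge H (m , f , f-inj , along , closing) =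
  f fzero , f last , Adj-sym H closing , _ , walkThrough (suc (suc m)) f along′
  where
  last : Fin (suc (suc (suc m)))
  last = fromℕ (suc (suc m))
  not-closing : ∀ i → ¬ SameEdge (f fzero) (f last) (f (inject₁ i)) (f (fsuc i))
  not-closing i        (inj₂ (e , _)) = fromℕ≢inject₁ (sym (f-inj e))
  not-closing fzero    (inj₁ (_ , e)) with f-inj e
  ... | ()
  not-closing (fsuc i) (inj₁ (e , _)) with f-inj e
  ... | ()
  along′ : ∀ i → Adj (deleteEdge H (f fzero) (f last)) (f (inject₁ i)) (f (fsuc i))
  along′ i = deleteEdge⁺ H (f fzero) (f last) (along i) (not-closing i)

walk? : (H : Graph n) → ∀ x y k → Dec (Walk H x y k)
walk? H x y zero with x ≟ᶠ y
... | yes refl = yes (here tt)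
... | no x≢y   = no λ { (here _) → x≢y refl }
walk? H x y (suc k) with any? (λ z → Adj? H x z ×-dec walk? H z y k)
... | yes (z , xz , w) = yes (step tt xz w)
... | no ¬w            = no λ { (step _ xz w) → ¬w (_ , xz , w) }

Least : (ℕ → Set) → Set
Least P = ∃[ m ] (P m × ∀ j → P j → m ≤ j)

least : ∀ {P : ℕ → Set} → (∀ k → Dec (P k)) → ∀ k → P k → Least P
least P? zero    p = 0 , p , λ _ _ → z≤n
least P? (suc k) p with P? 0
... | yes p₀ = 0 , p₀ , λ _ _ → z≤n
... | no ¬p₀ with least (λ j → P? (suc j)) k p
...   | m , pm , minimal = suc m , pm , λ { zero p₀ → ⊥-elim (¬p₀ p₀) ; (suc j) pj → s≤s (minimal j pj) }

Shortest : Graph n → Fin n → Fin n → ℕ → Set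
Shortest H a b k = Walk H a b k × (∀ m → Walk H a b m → k ≤ m)

shortest : (H : Graph n) → Connected H → ∀ a b → ∃ (Shortest H a b)
shortest H connected a b = least (walk? H a b) (proj₁ (connected a b)) (proj₂ (connected a b))

Internal : Graph n → Fin n → Set
Internal H x = ∃[ u ] ∃[ w ] (u ≢ w × Adj H x u × Adj H x w)

internal? : (H : Graph n) → ∀ x → Dec (Internal H x)
internal? H x = any? λ u → any? λ w → ¬? (u ≟ᶠ w) ×-dec Adj? H x u ×-dec Adj? H x w

internals : Graph n → Subset n
internals H = subsetOf (internal? H)

γwconTree : Graph n → ℕ
γwconTree H = 1 ⊔ ∣ internals H ∣

module _ (H : Graph n) where

  shortest⇒internal : ∀ {a b k} → Shortest H a b k → Internal H a → Internal H b → WalkIn H (Internal H) a b k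
  shortest⇒internal (here _ , _) ia ib = here ia
  shortest⇒internal (step _ ab (here _) , _) ia ib = step ia ab (here ib)
  shortest⇒internal {a} (step _ ay (step {b = z} {k = k} _ yz w) , minimal) ia ib =
    step ia ay (shortest⇒internal (step tt yz w , minimal′) iy ib)
    where
    minimal′ : ∀ m → Walk H _ _ m → suc k ≤ m
    minimal′ m w′ with minimal (suc m) (step tt ay w′)
    ... | s≤s le = le
    iy : Internal H _
    iy with a ≟ᶠ z
    ... | no a≢z  = a , z , a≢z , Adj-sym H ay , yz
    ... | yes refl = ⊥-elim (<-irrefl refl (≤-trans (n≤1+n _) (minimal k w)))

  internal-dominating : ∀ {x z k} → Walk H x z k → Internal H z → Internal H x ⊎ ∃[ u ] (Internal H u × Adj H u x)
  internal-dominating (here _) iz = inj₁ iz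
  internal-dominating {x} (step {b = y} _ xy w) iz with internal-dominating w iz
  ... | inj₁ iy = inj₂ (y , iy , Adj-sym H xy)
  ... | inj₂ (u , iu , uy) with u ≟ᶠ x
  ...   | yes refl = inj₁ iu
  ...   | no u≢x   = inj₂ (y , (x , u , (λ e → u≢x (sym e)) , Adj-sym H xy , Adj-sym H uy) , Adj-sym H xy)

  noInternal⇒star : (∀ x → ¬ Internal H x) → ∀ {x z k} → Walk H x z k → x ≡ z ⊎ Adj H z x
  noInternal⇒star none (here _) = inj₁ refl
  noInternal⇒star none {x} (step {b = y} _ xy w) with noInternal⇒star none w
  ... | inj₁ refl = inj₂ (Adj-sym H xy)
  ... | inj₂ zy with x ≟ᶠ _
  ...   | yes x≡z = inj₁ x≡z
  ...   | no x≢z  = ⊥-elim (none y (x , _ , x≢z , Adj-sym H xy , Adj-sym H zy))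

  avoiding⇒deleteEdge : ∀ {x u a b k} → WalkIn H (_≢ x) a b k → Walk (deleteEdge H x u) a b k
  avoiding⇒deleteEdge (here _) = here tt
  avoiding⇒deleteEdge {x} {u} (step a≢x ab w) = step tt (deleteEdge⁺ H x u ab not-xu) (avoiding⇒deleteEdge w)
    where
    not-xu : ¬ SameEdge x u _ _
    not-xu (inj₁ (a≡x , _)) = a≢x a≡x
    not-xu (inj₂ (_ , b≡x)) = first∈ w b≡x

  internals⊆wcd : Acyclic H → ∀ D → IsWCD H D → internals H ⊆ D
  internals⊆wcd acyclic D (dominating , convex) {x} x∈ with x ∈? D | ∈subsetOf⁻ (internal? H) x∈
  ... | yes x∈D | _ = x∈D
  ... | no x∉D | u , w , u≢w , xu , xw =
    ⊥-elim (acyclic⇒bridge H acyclic xu (step tt xw′ (proj₂ (reverse (avoiding⇒deleteEdge (proj₂ u⇝w))))))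
    where
    D⇒≢x : ∀ {y} → y ∈ D → y ≢ x
    D⇒≢x y∈D refl = x∉D y∈D
    toD : ∀ y → Adj H x y → ∃[ s ] (s ∈ D × ∃[ l ] WalkIn H (_≢ x) y s l)
    toD y xy with dominating y
    ... | inj₁ y∈D = y , y∈D , 0 , here (D⇒≢x y∈D)
    ... | inj₂ (s , s∈D , sy) = s , s∈D , 1 , step (λ e → Adj⇒≢ H xy (sym e)) (Adj-sym H sy) (here (D⇒≢x s∈D))
    u⇝w : ∃[ l ] WalkIn H (_≢ x) u w l
    u⇝w with toD u xu | toD w xw
    ... | s , s∈D , _ , u⇝s | t , t∈D , _ , w⇝t = _ ,
      u⇝s ++ʷ (mapWalk D⇒≢x (proj₁ (proj₂ (convex s t s∈D t∈D))) ++ʷ proj₂ (reverse w⇝t))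
    xw′ : Adj (deleteEdge H x u) x w
    xw′ = deleteEdge⁺ H x u xw λ { (inj₁ (_ , w≡u)) → u≢w (sym w≡u) ; (inj₂ (x≡u , _)) → Adj⇒≢ H xu x≡u }

  noInternal⇒wcd : Connected H → (∀ x → ¬ Internal H x) → ∀ z → IsWCD H ⁅ z ⁆
  noInternal⇒wcd connected none z = dominating , convex
    where
    dominating : Dominating H ⁅ z ⁆
    dominating v with noInternal⇒star none (proj₂ (connected v z))
    ... | inj₁ refl = inj₁ (x∈⁅x⁆ z)
    ... | inj₂ zv   = inj₂ (z , x∈⁅x⁆ z , zv)
    convex : WeaklyConvex H ⁅ z ⁆
    convex a b a∈ b∈ with x∈⁅y⁆⇒x≡y z a∈ | x∈⁅y⁆⇒x≡y z b∈
    ... | refl | refl = 0 , here a∈ , λ _ _ → z≤n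

  internals-wcd : Connected H → ∀ {z} → Internal H z → IsWCD H (internals H)
  internals-wcd connected {z} iz = dominating , convex
    where
    dominating : Dominating H (internals H)
    dominating v with internal-dominating (proj₂ (connected v z)) iz
    ... | inj₁ iv             = inj₁ (∈subsetOf⁺ (internal? H) iv)
    ... | inj₂ (u , iu , uv) = inj₂ (u , ∈subsetOf⁺ (internal? H) iu , uv)
    convex : WeaklyConvex H (internals H)
    convex a b a∈ b∈ with shortest H connected a b
    ... | k , sh = k , mapWalk (∈subsetOf⁺ (internal? H)) inner , proj₂ sh
      where
      inner : WalkIn H (Internal H) a b k
      inner = shortest⇒internal sh (∈subsetOf⁻ (internal? H) a∈) (∈subsetOf⁻ (internal? H) b∈)

γwcon-tree : ∀ {n} (H : Graph (suc n)) → IsTree H → γwcon≡ H (γwconTree H)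
γwcon-tree {n} H (connected , acyclic) = existence , minimality
  where
  minimality : ∀ D → IsWCD H D → γwconTree H ≤ ∣ D ∣
  minimality D wcd = ⊔-lub D-nonempty (p⊆q⇒∣p∣≤∣q∣ (internals⊆wcd H acyclic D wcd))
    where
    D-nonempty : 1 ≤ ∣ D ∣
    D-nonempty with proj₁ wcd fzero
    ... | inj₁ 0∈D             = x∈p⇒1≤∣p∣ 0∈D
    ... | inj₂ (s , s∈D , _) = x∈p⇒1≤∣p∣ s∈D
  existence : ∃[ D ] (IsWCD H D × ∣ D ∣ ≡ γwconTree H)
  existence with nonempty? (internals H)
  ... | yes (z , z∈) =
    internals H , internals-wcd H connected (∈subsetOf⁻ (internal? H) z∈) , sym (m≤n⇒m⊔n≡n (x∈p⇒1≤∣p∣ z∈))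
  ... | no empty =
    ⁅ fzero ⁆ , noInternal⇒wcd H connected none fzero ,
    trans (∣⁅x⁆∣≡1 (fzero {n = n})) (cong (1 ⊔_) (sym ∣internals∣≡0))
    where
    none : ∀ x → ¬ Internal H x
    none x ix = empty (x , ∈subsetOf⁺ (internal? H) ix)
    ∣internals∣≡0 : ∣ internals H ∣ ≡ 0
    ∣internals∣≡0 = trans (cong ∣_∣ (Empty-unique empty)) (∣⊥∣≡0 (suc n))

γwcon-unique : (H : Graph n) → ∀ {a b} → γwcon≡ H a → γwcon≡ H b → a ≡ b
γwcon-unique H ((D , wcd , ∣D∣≡a) , a-min) ((D′ , wcd′ , ∣D′∣≡b) , b-min) =
  ≤-antisym (subst (_ ≤_) ∣D′∣≡b (a-min D′ wcd′)) (subst (_ ≤_) ∣D∣≡a (b-min D wcd))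

internals-mono : (H H′ : Graph n) → (∀ x y → Adj H x y → Adj H′ x y) → internals H ⊆ internals H′
internals-mono H H′ H⊆H′ x∈ with ∈subsetOf⁻ (internal? H) x∈
... | u , w , u≢w , xu , xw = ∈subsetOf⁺ (internal? H′) (u , w , u≢w , H⊆H′ _ _ xu , H⊆H′ _ _ xw)

γwconTree-cong : (H H′ : Graph n) → (∀ x y → Adj H x y → Adj H′ x y) → (∀ x y → Adj H′ x y → Adj H x y) →
                 γwconTree H ≡ γwconTree H′
γwconTree-cong H H′ H⊆H′ H′⊆H =
  cong (λ p → 1 ⊔ ∣ p ∣) (⊆-antisym (internals-mono H H′ H⊆H′) (internals-mono H′ H H′⊆H))

γwconTree-except : (H H′ : Graph n) (z : Fin n) → (∀ x → x ≢ z → Internal H x → Internal H′ x) →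
                   γwconTree H ≤ suc (γwconTree H′)
γwconTree-except H H′ z transfer = 1⊔-bound (∣p∣≤1+∣q∣ (internals H) (internals H′) z transfer′)
  where
  transfer′ : ∀ {x} → x ≢ z → x ∈ internals H → x ∈ internals H′
  transfer′ {x} x≢z x∈ = ∈subsetOf⁺ (internal? H′) (transfer x x≢z (∈subsetOf⁻ (internal? H) x∈))
  1⊔-bound : ∀ {a b} → a ≤ suc b → 1 ⊔ a ≤ suc (1 ⊔ b)
  1⊔-bound {zero}  _         = s≤s z≤n
  1⊔-bound {suc a} (s≤s a≤b) = s≤s (≤-trans a≤b (m≤n⊔m 1 _))

Between : ℕ → ℕ → ℕ → Set
Between x y c = (x ≤ c × c ≤ y) ⊎ (y ≤ c × c ≤ x)

Between-same : ∀ {x c} → Between x x c → c ≡ x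
Between-same (inj₁ (x≤c , c≤x)) = ≤-antisym c≤x x≤c
Between-same (inj₂ (x≤c , c≤x)) = ≤-antisym c≤x x≤c

Between-step : ∀ {x x′ y c} → Between x y c → c ≢ x → x′ ≤ suc x → x ≤ suc x′ → Between x′ y c
Between-step (inj₁ (x≤c , c≤y)) c≢x x′≤1+x _ = inj₁ (≤-trans x′≤1+x (≤∧≢⇒< x≤c (λ e → c≢x (sym e))) , c≤y)
Between-step (inj₂ (y≤c , c≤x)) c≢x _ x≤1+x′ = inj₂ (y≤c , ≤-pred (≤-trans (≤∧≢⇒< c≤x c≢x) x≤1+x′))

module _ {S : Set} (μ : S → ℕ) (f : S → ℕ) (b : ℕ)
         (advance : ∀ s → f s ≡ b ⊎ ∃[ s′ ] (μ s′ < μ s × f s′ ≤ suc (f s) × f s ≤ suc (f s′))) where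

  intermediate-value : ∀ s c → Between (f s) b c → ∃[ s* ] f s* ≡ c
  intermediate-value s = go (suc (μ s)) s ≤-refl
    where
    go : ∀ K s → μ s < K → ∀ c → Between (f s) b c → ∃[ s* ] f s* ≡ c
    go (suc K) s (s≤s μs≤K) c between with c ≟ⁿ f s | advance s
    ... | yes c≡fs | _ = s , sym c≡fs
    ... | no c≢fs | inj₁ fs≡b = ⊥-elim (c≢fs (Between-same (subst (λ t → Between (f s) t c) (sym fs≡b) between)))
    ... | no c≢fs | inj₂ (s′ , μs′<μs , up , down) =
      go K s′ (<-≤-trans μs′<μs μs≤K) c (Between-step between c≢fs up down)

iterate : (A → A) → ℕ → A → A
iterate f zero    x = x
iterate f (suc k) x = iterate f k (f x)

module Rooted {n} (G : Graph n) (r : Fin n) where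

  record ParentMap : Set where
    field
      parent       : Fin n → Fin n
      parent-root  : parent r ≡ r
      parent-edge  : ∀ v → v ≢ r → Adj G v (parent v)
      reaches-root : ∀ v → ∃[ k ] iterate parent k v ≡ r

  walkToRoot : (π : Fin n → Fin n) (H : Graph n) → (∀ z → z ≢ r → Adj H z (π z)) →
               ∀ k x → iterate π k x ≡ r → ∃[ l ] Walk H x r l
  walkToRoot π H edge zero    x refl = 0 , here tt
  walkToRoot π H edge (suc k) x reach with x ≟ᶠ r
  ... | yes refl = 0 , here tt
  ... | no x≢r   = suc _ , step tt (edge x x≢r) (proj₂ (walkToRoot π H edge k (π x) reach))

  module Tree (P : ParentMap) where
    open ParentMap P

    leastSteps : ∀ v → Least (λ k → iterate parent k v ≡ r)
    leastSteps v = least (λ k → iterate parent k v ≟ᶠ r) (proj₁ (reaches-root v)) (proj₂ (reaches-root v))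

    height : Fin n → ℕ
    height v = proj₁ (leastSteps v)

    height-reaches : ∀ v → iterate parent (height v) v ≡ r
    height-reaches v = proj₁ (proj₂ (leastSteps v))

    height-minimal : ∀ v k → iterate parent k v ≡ r → height v ≤ k
    height-minimal v = proj₂ (proj₂ (leastSteps v))

    height-parent< : ∀ v → v ≢ r → height (parent v) < height v
    height-parent< v v≢r with height v | height-reaches v
    ... | zero  | v≡r   = ⊥-elim (v≢r v≡r)
    ... | suc k | reach = s≤s (height-minimal (parent v) k reach)

    height-parent≤ : ∀ v → height (parent v) ≤ height v
    height-parent≤ v with v ≟ᶠ r
    ... | yes refl rewrite parent-root = ≤-refl
    ... | no v≢r   = <⇒≤ (height-parent< v v≢r)

    height-iterate≤ : ∀ k v → height (iterate parent k v) ≤ height v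
    height-iterate≤ zero    v = ≤-refl
    height-iterate≤ (suc k) v = ≤-trans (height-iterate≤ k (parent v)) (height-parent≤ v)

    parent≢self : ∀ v → v ≢ r → parent v ≢ v
    parent≢self v v≢r e = <-irrefl (cong height e) (height-parent< v v≢r)

    parent-parent≢ : ∀ v → v ≢ r → parent (parent v) ≢ v
    parent-parent≢ v v≢r e with parent v ≟ᶠ r
    ... | yes pv≡r = v≢r (trans (sym e) (trans (cong parent pv≡r) parent-root))
    ... | no pv≢r  =
      <-irrefl refl (<-trans (subst (λ t → height t < height (parent v)) e h-ppv<h-pv) (height-parent< v v≢r))
      where
      h-ppv<h-pv : height (parent (parent v)) < height (parent v)
      h-ppv<h-pv = height-parent< (parent v) pv≢r

    IsChild : Fin n → Fin n → Set
    IsChild x y = x ≢ r × parent x ≡ y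

    isChild? : ∀ x y → Dec (IsChild x y)
    isChild? x y = ¬? (x ≟ᶠ r) ×-dec (parent x ≟ᶠ y)

    treeRelation : SimpleRelation n
    treeRelation = record
      { _∼_      = λ x y → IsChild x y ⊎ IsChild y x
      ; _∼?_     = λ x y → isChild? x y ⊎-dec isChild? y x
      ; ∼-sym    = λ { (inj₁ c) → inj₂ c ; (inj₂ c) → inj₁ c }
      ; ∼-irrefl = λ { (inj₁ (x≢r , e)) → parent≢self _ x≢r e ; (inj₂ (x≢r , e)) → parent≢self _ x≢r e }
      }

    tree : Graph n
    tree = toGraph treeRelation

    tree⁻ : ∀ {x y} → Adj tree x y → IsChild x y ⊎ IsChild y x
    tree⁻ = toGraph⁻ treeRelation

    tree⁺ : ∀ {x y} → IsChild x y ⊎ IsChild y x → Adj tree x y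
    tree⁺ = toGraph⁺ treeRelation

    tree⊆G : ∀ {x y} → Adj tree x y → Adj G x y
    tree⊆G {x} {y} xy with tree⁻ {x} {y} xy
    ... | inj₁ (x≢r , refl) = parent-edge _ x≢r
    ... | inj₂ (y≢r , refl) = Adj-sym G (parent-edge _ y≢r)

    internal⇒child : ∀ {v} → Internal tree v → ∃[ c ] IsChild c v
    internal⇒child {v} (u , w , u≢w , vu , vw) with tree⁻ {v} {u} vu | tree⁻ {v} {w} vw
    ... | inj₂ u-child       | _                  = u , u-child
    ... | inj₁ _             | inj₂ w-child       = w , w-child
    ... | inj₁ (_ , pv≡u)  | inj₁ (_ , pv≡w)  = ⊥-elim (u≢w (trans (sym pv≡u) pv≡w))

    tree-connected : Connected tree
    tree-connected a b = _ , (proj₂ (toRoot a) ++ʷ proj₂ (reverse (proj₂ (toRoot b))))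
      where
      toRoot : ∀ x → ∃[ l ] Walk tree x r l
      toRoot x = walkToRoot parent tree (λ z z≢r → tree⁺ (inj₁ (z≢r , refl)))
                            (proj₁ (reaches-root x)) x (proj₂ (reaches-root x))

    Descendant : Fin n → Fin n → Set
    Descendant u x = ∃[ k ] iterate parent k x ≡ u

    parent-not-descendant : ∀ u → u ≢ r → ¬ Descendant u (parent u)
    parent-not-descendant u u≢r (k , e) = <-irrefl refl (<-≤-trans (height-parent< u u≢r) h-u≤h-pu)
      where
      h-u≤h-pu : height u ≤ height (parent u)
      h-u≤h-pu = subst (λ t → height t ≤ height (parent u)) e (height-iterate≤ k (parent u))

    descendants-closed : ∀ {u s t a b k} → SameEdge s t u (parent u) → Walk (deleteEdge tree s t) a b k →
                         Descendant u a → Descendant u b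
    descendants-closed st (here _) d = d
    descendants-closed {u} {s} {t} st (step {a = x} {b = y} _ xy w) (k , xₖ≡u) with deleteEdge⁻ tree s t {x} {y} xy
    ... | xy′ , not-st = descendants-closed st w (next (tree⁻ {x} {y} xy′) k xₖ≡u)
      where
      next : IsChild x y ⊎ IsChild y x → ∀ k → iterate parent k x ≡ u → Descendant u y
      next (inj₁ (_ , refl)) zero    refl = ⊥-elim (not-st st)
      next (inj₁ (_ , refl)) (suc k) e    = k , e
      next (inj₂ (_ , refl)) k       e    = suc k , e

    tree-acyclic : Acyclic tree
    tree-acyclic cycle with cycle⇒nonBridge tree cycle
    ... | u , v , uv , _ , w with tree⁻ {u} {v} uv
    ...   | inj₁ (u≢r , refl) = parent-not-descendant u u≢r (descendants-closed (inj₁ (refl , refl)) w (0 , refl))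
    ...   | inj₂ (v≢r , refl) =
      parent-not-descendant v v≢r (descendants-closed (inj₂ (refl , refl)) (proj₂ (reverse w)) (0 , refl))

    tree-spanning : IsSpanningTree G tree
    tree-spanning = (λ _ _ → tree⊆G) , tree-connected , tree-acyclic

  tree-ext : ∀ (P P′ : ParentMap) → (∀ x → ParentMap.parent P x ≡ ParentMap.parent P′ x) →
             ∀ x y → Adj (Tree.tree P) x y → Adj (Tree.tree P′) x y
  tree-ext P P′ same x y xy with Tree.tree⁻ P {x} {y} xy
  ... | inj₁ (x≢r , e) = Tree.tree⁺ P′ (inj₁ (x≢r , trans (sym (same x)) e))
  ... | inj₂ (y≢r , e) = Tree.tree⁺ P′ (inj₂ (y≢r , trans (sym (same y)) e))

  γwcon : ParentMap → ℕ
  γwcon P = γwconTree (Tree.tree P)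

  module FromSpanningTree (T : Graph n) (spanning : IsSpanningTree G T) where

    distance : Fin n → ℕ
    distance x = proj₁ (shortest T (proj₁ (proj₂ spanning)) x r)

    distance-minimal : ∀ {x k} → Walk T x r k → distance x ≤ k
    distance-minimal {x} {k} = proj₂ (proj₂ (shortest T (proj₁ (proj₂ spanning)) x r)) k

    nextHop : ∀ x → ∃[ y ] ((x ≡ r × y ≡ r) ⊎ (Adj T x y × distance y < distance x))
    nextHop x with shortest T (proj₁ (proj₂ spanning)) x r
    ... | zero  , (here _ , _)        = r , inj₁ (refl , refl)
    ... | suc k , (step _ xy w , _)  = _ , inj₂ (xy , s≤s (distance-minimal w))

    parent : Fin n → Fin n
    parent x = proj₁ (nextHop x)

    parent-root : parent r ≡ r
    parent-root with nextHop r
    ... | _ , inj₁ (_ , y≡r) = y≡r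
    ... | _ , inj₂ (_ , closer) = ⊥-elim (n≮0 (<-≤-trans closer (distance-minimal (here tt))))

    parent-T : ∀ v → v ≢ r → Adj T v (parent v)
    parent-T v v≢r with nextHop v
    ... | _ , inj₁ (v≡r , _) = ⊥-elim (v≢r v≡r)
    ... | _ , inj₂ (vy , _)  = vy

    parent-closer : ∀ v → v ≢ r → distance (parent v) < distance v
    parent-closer v v≢r with nextHop v
    ... | _ , inj₁ (v≡r , _)    = ⊥-elim (v≢r v≡r)
    ... | _ , inj₂ (_ , closer) = closer

    reaches-root : ∀ v → ∃[ k ] iterate parent k v ≡ r
    reaches-root v = reach (suc (distance v)) v ≤-refl
      where
      reach : ∀ K v → distance v < K → ∃[ k ] iterate parent k v ≡ r
      reach (suc K) v (s≤s d≤K) with v ≟ᶠ r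
      ... | yes v≡r = 0 , v≡r
      ... | no v≢r with reach K (parent v) (<-≤-trans (parent-closer v v≢r) d≤K)
      ...   | k , reached = suc k , reached

    parentMap : ParentMap
    parentMap = record
      { parent       = parent
      ; parent-root  = parent-root
      ; parent-edge  = λ v v≢r → proj₁ spanning v (parent v) (parent-T v v≢r)
      ; reaches-root = reaches-root
      }

    open Tree parentMap using (tree; tree⁻; tree⁺; isChild?)

    tree⊆T : ∀ x y → Adj tree x y → Adj T x y
    tree⊆T x y xy with tree⁻ {x} {y} xy
    ... | inj₁ (x≢r , refl) = parent-T x x≢r
    ... | inj₂ (y≢r , refl) = Adj-sym T (parent-T y y≢r)

    T⊆tree : ∀ x y → Adj T x y → Adj tree x y
    T⊆tree x y xy with isChild? x y | isChild? y x
    ... | yes c | _     = tree⁺ (inj₁ c)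
    ... | no _  | yes c = tree⁺ (inj₂ c)
    ... | no ¬xy | no ¬yx =
      ⊥-elim (acyclic⇒bridge T (proj₂ (proj₂ spanning)) xy
                               (proj₂ (toRoot x) ++ʷ proj₂ (reverse (proj₂ (toRoot y)))))
      where
      avoids : ∀ z → z ≢ r → Adj (deleteEdge T x y) z (parent z)
      avoids z z≢r = deleteEdge⁺ T x y (parent-T z z≢r) λ
        { (inj₁ (refl , e)) → ¬xy (z≢r , e)
        ; (inj₂ (refl , e)) → ¬yx (z≢r , e) }
      toRoot : ∀ z → ∃[ l ] Walk (deleteEdge T x y) z r l
      toRoot z = walkToRoot parent (deleteEdge T x y) avoids (proj₁ (reaches-root z)) z (proj₂ (reaches-root z))

  fromSpanningTree : (T : Graph n) → IsSpanningTree G T → Σ ParentMap λ P → γwcon P ≡ γwconTree T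
  fromSpanningTree T spanning = parentMap , γwconTree-cong (Tree.tree parentMap) T tree⊆T T⊆tree
    where open FromSpanningTree T spanning

  module Reparent (P : ParentMap) (v q : Fin n) (v≢r : v ≢ r) (vq : Adj G v q)
                  (q↛v : ∀ j → iterate (ParentMap.parent P) j q ≢ v) where
    open ParentMap P

    parent′ : Fin n → Fin n
    parent′ x with x ≟ᶠ v
    ... | yes _ = q
    ... | no _  = parent x

    parent′-v : parent′ v ≡ q
    parent′-v with v ≟ᶠ v
    ... | yes _  = refl
    ... | no v≢v = ⊥-elim (v≢v refl)

    parent′-other : ∀ {x} → x ≢ v → parent′ x ≡ parent x
    parent′-other {x} x≢v with x ≟ᶠ v
    ... | yes x≡v = ⊥-elim (x≢v x≡v)
    ... | no _    = refl

    parent′-cases : ∀ x → (x ≡ v × parent′ x ≡ q) ⊎ (x ≢ v × parent′ x ≡ parent x)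
    parent′-cases x = cases (x ≟ᶠ v)
      where
      cases : Dec (x ≡ v) → (x ≡ v × parent′ x ≡ q) ⊎ (x ≢ v × parent′ x ≡ parent x)
      cases (yes refl) = inj₁ (refl , parent′-v)
      cases (no x≢v)   = inj₂ (x≢v , parent′-other x≢v)

    iterate-avoiding : ∀ y → (∀ j → iterate parent j y ≢ v) → ∀ k → iterate parent′ k y ≡ iterate parent k y
    iterate-avoiding y y↛v zero    = refl
    iterate-avoiding y y↛v (suc k) rewrite parent′-other (y↛v 0) = iterate-avoiding (parent y) (λ j → y↛v (suc j)) k

    reaches-root′ : ∀ K x → iterate parent K x ≡ r → ∃[ k ] iterate parent′ k x ≡ r
    reaches-root′ zero    x reached = 0 , reached
    reaches-root′ (suc K) x reached with x ≟ᶠ v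
    ... | yes refl = via-q (reaches-root q)
      where
      via-q : ∃[ k ] iterate parent k q ≡ r → ∃[ k ] iterate parent′ k v ≡ r
      via-q (k , q-reached) =
        suc k , trans (cong (iterate parent′ k) parent′-v) (trans (iterate-avoiding q q↛v k) q-reached)
    ... | no x≢v with reaches-root′ K (parent x) reached
    ...   | k , reached′ = suc k , trans (cong (iterate parent′ k) (parent′-other x≢v)) reached′

    reparented : ParentMap
    reparented = record
      { parent       = parent′
      ; parent-root  = trans (parent′-other (λ r≡v → v≢r (sym r≡v))) parent-root
      ; parent-edge  = edge′
      ; reaches-root = λ x → reaches-root′ (proj₁ (reaches-root x)) x (proj₂ (reaches-root x))
      }
      where
      edge′ : ∀ x → x ≢ r → Adj G x (parent′ x)
      edge′ x x≢r with x ≟ᶠ v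
      ... | yes refl = vq
      ... | no _     = parent-edge x x≢r

    module Old = Tree P
    module New = Tree reparented

    new⇒old : ∀ {x y} → x ≢ v → x ≢ q → Adj New.tree x y → Adj Old.tree x y
    new⇒old {x} {y} x≢v x≢q xy with New.tree⁻ {x} {y} xy
    ... | inj₁ (x≢r , e) = Old.tree⁺ (inj₁ (x≢r , trans (sym (parent′-other x≢v)) e))
    ... | inj₂ (y≢r , e) with parent′-cases y
    ...   | inj₁ (refl , p′v≡q)   = ⊥-elim (x≢q (trans (sym e) p′v≡q))
    ...   | inj₂ (y≢v , p′y≡py) = Old.tree⁺ (inj₂ (y≢r , trans (sym p′y≡py) e))

    old⇒new : ∀ {x y} → x ≢ v → x ≢ parent v → Adj Old.tree x y → Adj New.tree x y
    old⇒new {x} {y} x≢v x≢pv xy with Old.tree⁻ {x} {y} xy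
    ... | inj₁ (x≢r , e) = New.tree⁺ (inj₁ (x≢r , trans (parent′-other x≢v) e))
    ... | inj₂ (y≢r , e) with parent′-cases y
    ...   | inj₁ (refl , _)        = ⊥-elim (x≢pv (sym e))
    ...   | inj₂ (y≢v , p′y≡py) = New.tree⁺ (inj₂ (y≢r , trans p′y≡py e))

    internal-v-old⇒new : Internal Old.tree v → Internal New.tree v
    internal-v-old⇒new iv with Old.internal⇒child iv
    ... | c , c≢r , pc≡v =
      q , c , q≢c , New.tree⁺ (inj₁ (v≢r , parent′-v)) , New.tree⁺ (inj₂ (c≢r , trans (parent′-other c≢v) pc≡v))
      where
      c≢v : c ≢ v
      c≢v refl = Old.parent≢self v v≢r pc≡v
      q≢c : q ≢ c
      q≢c refl = q↛v 1 pc≡v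

    internal-v-new⇒old : Internal New.tree v → Internal Old.tree v
    internal-v-new⇒old iv with New.internal⇒child iv
    ... | c , c≢r , p′c≡v = parent v , c , pv≢c , Old.tree⁺ (inj₁ (v≢r , refl)) , Old.tree⁺ (inj₂ (c≢r , pc≡v))
      where
      c≢v : c ≢ v
      c≢v refl = Adj⇒≢ G vq (sym (trans (sym parent′-v) p′c≡v))
      pc≡v : parent c ≡ v
      pc≡v = trans (sym (parent′-other c≢v)) p′c≡v
      pv≢c : parent v ≢ c
      pv≢c refl = Old.parent-parent≢ v v≢r pc≡v

    internal-new⇒old : ∀ x → x ≢ q → Internal New.tree x → Internal Old.tree x
    internal-new⇒old x x≢q ix@(u , w , u≢w , xu , xw) = cases (x ≟ᶠ v)
      where
      cases : Dec (x ≡ v) → Internal Old.tree x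
      cases (yes refl) = internal-v-new⇒old ix
      cases (no x≢v)   = u , w , u≢w , new⇒old x≢v x≢q xu , new⇒old x≢v x≢q xw

    internal-old⇒new : ∀ x → x ≢ parent v → Internal Old.tree x → Internal New.tree x
    internal-old⇒new x x≢pv ix@(u , w , u≢w , xu , xw) = cases (x ≟ᶠ v)
      where
      cases : Dec (x ≡ v) → Internal New.tree x
      cases (yes refl) = internal-v-old⇒new ix
      cases (no x≢v)   = u , w , u≢w , old⇒new x≢v x≢pv xu , old⇒new x≢v x≢pv xw

    γwcon-new≤ : γwcon reparented ≤ suc (γwcon P)
    γwcon-new≤ = γwconTree-except New.tree Old.tree q internal-new⇒old

    γwcon-old≤ : γwcon P ≤ suc (γwcon reparented)
    γwcon-old≤ = γwconTree-except Old.tree New.tree (parent v) internal-old⇒new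

  module Towards (P₁ : ParentMap) where
    open ParentMap P₁ using ()
      renaming (parent to parent₁; parent-root to parent₁-root; parent-edge to parent₁-edge)
    open Tree P₁ using ()
      renaming (height to height₁; height-parent≤ to height₁-parent≤; height-parent< to height₁-parent<)

    Mismatch : ParentMap → Fin n → Set
    Mismatch P x = ParentMap.parent P x ≢ parent₁ x

    mismatch? : ∀ P x → Dec (Mismatch P x)
    mismatch? P x = ¬? (ParentMap.parent P x ≟ᶠ parent₁ x)

    mismatches : ParentMap → Subset n
    mismatches P = subsetOf (mismatch? P)

    step-towards : ∀ P → γwcon P ≡ γwcon P₁ ⊎
                   ∃[ P′ ] ( ∣ mismatches P′ ∣ < ∣ mismatches P ∣
                           × γwcon P′ ≤ suc (γwcon P) × γwcon P ≤ suc (γwcon P′))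
    step-towards P with any? (mismatch? P)
    ... | no none =
      inj₁ (γwconTree-cong (Tree.tree P) (Tree.tree P₁)
                           (tree-ext P P₁ agree) (tree-ext P₁ P (λ x → sym (agree x))))
      where
      agree : ∀ x → ParentMap.parent P x ≡ parent₁ x
      agree x with ParentMap.parent P x ≟ᶠ parent₁ x
      ... | yes e = e
      ... | no ne = ⊥-elim (none (x , ne))
    ... | yes (x₀ , x₀-mismatch)
        with least (λ k → any? λ x → mismatch? P x ×-dec (height₁ x ≟ⁿ k)) (height₁ x₀) (x₀ , x₀-mismatch , refl)
    ...   | _ , (v , v-mismatch , refl) , lowest = inj₂ (reparented , fewer , γwcon-new≤ , γwcon-old≤)
      where
      open ParentMap P using (parent)
      below-agree : ∀ y → height₁ y < height₁ v → parent y ≡ parent₁ y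
      below-agree y lower with parent y ≟ᶠ parent₁ y
      ... | yes e = e
      ... | no ne = ⊥-elim (<-irrefl refl (<-≤-trans lower (lowest (height₁ y) (y , ne , refl))))
      v≢r : v ≢ r
      v≢r refl = v-mismatch (trans (ParentMap.parent-root P) (sym parent₁-root))
      -- Below v the maps agree, so the P-chain from such y is its P₁-chain, whose heights only drop.
      below↛v : ∀ j y → height₁ y < height₁ v → iterate parent j y ≢ v
      below↛v zero    y lower refl = <-irrefl refl lower
      below↛v (suc j) y lower rewrite below-agree y lower =
        below↛v j (parent₁ y) (≤-<-trans (height₁-parent≤ y) lower)
      open Reparent P v (parent₁ v) v≢r (parent₁-edge v v≢r) (λ j → below↛v j (parent₁ v) (height₁-parent< v v≢r))
      fewer : ∣ mismatches reparented ∣ < ∣ mismatches P ∣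
      fewer = p⊂q⇒∣p∣<∣q∣ (⊆ , v , ∈subsetOf⁺ (mismatch? P) v-mismatch ,
                           λ v∈ → ∈subsetOf⁻ (mismatch? reparented) v∈ parent′-v)
        where
        ⊆ : mismatches reparented ⊆ mismatches P
        ⊆ {x} x∈ with parent′-cases x | ∈subsetOf⁻ (mismatch? reparented) x∈
        ... | inj₁ (refl , p′v≡q) | m = ⊥-elim (m p′v≡q)
        ... | inj₂ (x≢v , p′x≡px) | m = ∈subsetOf⁺ (mismatch? P) λ e → m (trans p′x≡px e)

γwcon-empty : (H : Graph 0) → ∀ {b} → γwcon≡ H b → b ≡ 0
γwcon-empty H (([] , _ , ∣[]∣≡b) , _) = sym ∣[]∣≡b

corollary4p9 :
    ∀ (n : ℕ) (G : Graph n) → Connected G →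
    ∀ (T₁ T₂ : Graph n) (a b c : ℕ) →
    IsSpanningTree G T₁ → γwcon≡ T₁ a →
    IsSpanningTree G T₂ → γwcon≡ T₂ b →
    a ≤ c → c ≤ b →
    ∃[ T ] (IsSpanningTree G T × γwcon≡ T c)
corollary4p9 zero G _ T₁ T₂ a b c spanning₁ γ₁ _ γ₂ a≤c c≤b =
  T₁ , spanning₁ , subst (γwcon≡ T₁) (≤-antisym a≤c (≤-trans c≤b (subst (_≤ a) (sym (γwcon-empty T₂ γ₂)) z≤n))) γ₁
corollary4p9 (suc n) G _ T₁ T₂ a b c spanning₁ γ₁ spanning₂ γ₂ a≤c c≤b =
  tree , tree-spanning , subst (γwcon≡ tree) γ≡c (γwcon-tree tree (proj₂ tree-spanning))
  where
  open Rooted G fzero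
  asParentMap : ∀ {T a} → IsSpanningTree G T → γwcon≡ T a → Σ ParentMap λ P → γwcon P ≡ a
  asParentMap {T} spanning γ =
    proj₁ (fromSpanningTree T spanning) ,
    trans (proj₂ (fromSpanningTree T spanning)) (γwcon-unique T (γwcon-tree T (proj₂ spanning)) γ)
  P₁ : ParentMap
  P₁ = proj₁ (asParentMap spanning₁ γ₁)
  P₂ : ParentMap
  P₂ = proj₁ (asParentMap spanning₂ γ₂)
  open Towards P₁
  between : Between (γwcon P₂) (γwcon P₁) c
  between = inj₂ ( subst (_≤ c) (sym (proj₂ (asParentMap spanning₁ γ₁))) a≤c
                 , subst (c ≤_) (sym (proj₂ (asParentMap spanning₂ γ₂))) c≤b )
  attained : ∃[ P ] γwcon P ≡ c
  attained = intermediate-value (λ P → ∣ mismatches P ∣) γwcon (γwcon P₁) step-towards P₂ c between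
  open Tree (proj₁ attained) using (tree; tree-spanning)
  γ≡c : γwconTree tree ≡ c
  γ≡c = proj₂ attained
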